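{- Let $\pi$ be a parking function of length $n$. Every non-root ancestor in $\mathrm{PT}(\pi)$ of a vertex $v\in[n]$ lies to the left of $v$ in the word $\omega_\pi(1)\omega_\pi(2)\cdots\omega_\pi(n)$. Hence the records (left-to-right maxima) of $\omega_\pi$ coincide with the records of $\mathrm{PT}(\pi)$.
   Context: A parking function of length $n$ is a sequence $\pi=(a_1,\dots,a_n)$ in $[n]=\{1,\dots,n\}$ such that when cars $1,\dots,n$ enter in order a street with spots $1,\dots,n$, car $i$ parking in the first free spot $j\ge a_i$, all cars park. $\omega_\pi(j)$ is the car parked in spot $j$, $\omega_\pi(0)=0$. The parking tree $\mathrm{PT}(\pi)$ is the tree on vertex set $\{0,\dots,n\}$ rooted at $0$ with parent map $f_\pi(i)=\omega_\pi(\pi(i)-1)$. A non-root vertex $k$ of a tree rooted at $0$ is a record if $k$ is the largest label on the path from $k$ to the root. -}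

module Defs where

open import Data.Nat using (ℕ; zero; suc; _+_; _∸_; _≤_; _<_; _≡ᵇ_)
open import Data.Bool using (Bool; true; false; if_then_else_; _∧_)
open import Data.Nat using (_≤ᵇ_)
open import Data.List using (List; []; _∷_; length)
open import Data.Maybe using (Maybe; just; nothing; maybe; Is-just)
open import Data.Product using (_×_)
open import Data.List.Relation.Unary.All using (All)

-- Conventions: cars, spots and parking preferences are 1-based natural numbers.
-- A sequence π = (a₁,…,aₙ) is a list of naturals; car i (1 ≤ i ≤ n) has
-- preference aᵢ (the i-th list entry).  An occupancy is a map spot ↦ car,
-- where 0 means "empty".

Occ : Set
Occ = ℕ → ℕ

empty : Occ
empty _ = 0

firstFree : Occ → ℕ → ℕ → Maybe ℕ
firstFree occ a zero    = nothing
firstFree occ a (suc k) = if occ a ≡ᵇ 0 then just a else firstFree occ (suc a) k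

place : Occ → ℕ → ℕ → Occ
place occ j c x = if x ≡ᵇ j then c else occ x

-- cars i, i+1, … with the given preferences enter a street with spots 1..n;
-- returns nothing as soon as some car fails to find a free spot among a..n.
parkFrom : ℕ → ℕ → Occ → List ℕ → Maybe Occ
parkFrom n i occ []       = just occ
parkFrom n i occ (a ∷ as) with firstFree occ a (suc n ∸ a)
... | nothing = nothing
... | just j  = parkFrom n (suc i) (place occ j i) as

park : ℕ → List ℕ → Maybe Occ
park n π = parkFrom n 1 empty π

IsParkingFunction : ℕ → List ℕ → Set
IsParkingFunction n π =
  length π ≡' n × All (λ a → 1 ≤ a × a ≤ n) π × Is-just (park n π)
  where
    open import Relation.Binary.PropositionalEquality using () renaming (_≡_ to _≡'_)

ω : ℕ → List ℕ → ℕ → ℕ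
ω n π zero    = 0
ω n π (suc j) = maybe (λ occ → occ (suc j)) 0 (park n π)

-- π(i): the preference of car i (1-based; default 0 out of range)
entry : List ℕ → ℕ → ℕ
entry []       _             = 0
entry (a ∷ as) zero          = 0
entry (a ∷ as) (suc zero)    = a
entry (a ∷ as) (suc (suc i)) = entry as (suc i)

-- parent map of PT(π): f_π(i) = ω_π(π(i) − 1)
parent : ℕ → List ℕ → ℕ → ℕ
parent n π i = ω n π (entry π i ∸ 1)

iter : (ℕ → ℕ) → ℕ → ℕ → ℕ
iter f zero    x = x
iter f (suc k) x = f (iter f k x)

IsTreeRecord : ℕ → List ℕ → ℕ → Set
IsTreeRecord n π k = ∀ m → iter (parent n π) m k ≤ k

IsWordRecordAt : ℕ → List ℕ → ℕ → Set
IsWordRecordAt n π j = ∀ i → 1 ≤ i → i < j → ω n π i < ω n π j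

{-# OPTIONS --safe #-}
module Submission where

-- The car c parked at spot s skipped exactly the spots π(c), …, s − 1, all taken by earlier,
-- hence smaller, cars; its parent in PT(π) is the car at spot π(c) − 1, strictly left of s.
-- Iterating, the ancestors of c sit ever further left, so every ancestor of a left-to-right
-- maximum is smaller than it.  Conversely the spots left of s are covered by the skipped block
-- (cars < c), the parent's spot, and recursively the spots left of the parent, so every letter
-- left of c is bounded by c or one of its ancestors; for a tree record that bound is c itself.

open import Defs
open import Data.Nat using (ℕ; _≤_; _<_)
open import Data.List using (List)
open import Data.Product using (_×_)
open import Function.Bundles using (_⇔_)
open import Relation.Binary.PropositionalEquality using (_≡_; _≢_)

open import Data.Bool using (true; false)
open import Data.Empty using (⊥-elim)
open import Data.List using ([]; _∷_; length)
open import Data.List.Relation.Unary.All using (All; []; _∷_)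
open import Data.Maybe using (just; nothing)
open import Data.Nat using (zero; suc; _+_; _∸_; _≡ᵇ_; z≤n; s≤s; z<s; _≤?_; _≟_)
open import Data.Nat.Induction using (<-wellFounded)
open import Data.Nat.Properties
open import Data.Product using (_,_; proj₁; proj₂)
open import Data.Sum using (inj₁; inj₂)
open import Function.Base using (_∘_)
open import Function.Bundles using (mk⇔)
open import Induction.WellFounded using (Acc; acc)
open import Relation.Nullary using (yes; no; contradiction)
open import Relation.Binary.PropositionalEquality using (refl; sym; trans; cong; cong₂; subst; subst₂)

place-≡ : ∀ occ j c → place occ j c j ≡ c
place-≡ occ j c with j ≡ᵇ j | ≡⇒≡ᵇ j j refl
... | true | _ = refl

place-≢ : ∀ occ {j c x} → x ≢ j → place occ j c x ≡ occ x
place-≢ occ {j} {x = x} x≢j with x ≡ᵇ j | ≡ᵇ⇒≡ x j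
... | false | _ = refl
... | true | x≡j = contradiction (x≡j _) x≢j

firstFree-sound : ∀ occ a fuel {j} → firstFree occ a fuel ≡ just j →
  a ≤ j × j < a + fuel × occ j ≡ 0 × (∀ {t} → a ≤ t → t < j → occ t ≢ 0)
firstFree-sound occ a (suc fuel) {j} found with occ a ≡ᵇ 0 | ≡ᵇ⇒≡ (occ a) 0 | ≡⇒≡ᵇ (occ a) 0
firstFree-sound occ a (suc fuel) refl | true | free | _ =
  ≤-refl , m<m+n a z<s , free _ , λ a≤t t<a → contradiction (≤-<-trans a≤t t<a) (<-irrefl refl)
... | false | _ | a-taken with firstFree-sound occ (suc a) fuel found
... | a<j , j<1+a+fuel , free , taken =
  <⇒≤ a<j , subst (j <_) (sym (+-suc a fuel)) j<1+a+fuel , free , taken′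
  where
  taken′ : ∀ {t} → a ≤ t → t < j → occ t ≢ 0
  taken′ a≤t t<j with m≤n⇒m<n∨m≡n a≤t
  ... | inj₁ a<t = taken a<t t<j
  ... | inj₂ refl = a-taken

isOccupied : ℕ → ℕ
isOccupied zero    = 0
isOccupied (suc _) = 1

occupied : Occ → ℕ → ℕ
occupied occ zero    = 0
occupied occ (suc m) = isOccupied (occ (suc m)) + occupied occ m

occupied-empty : ∀ m → occupied empty m ≡ 0
occupied-empty zero    = refl
occupied-empty (suc m) = occupied-empty m

occupied≤ : ∀ occ m → occupied occ m ≤ m
occupied≤ occ zero    = z≤n
occupied≤ occ (suc m) with occ (suc m)
... | zero  = m≤n⇒m≤1+n (occupied≤ occ m)
... | suc _ = s≤s (occupied≤ occ m)

occupied-suc≡ : ∀ occ m → occupied occ (suc m) ≡ suc m → occ (suc m) ≢ 0 × occupied occ m ≡ m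
occupied-suc≡ occ m count≡ with occ (suc m)
... | zero  = ⊥-elim (1+n≰n (subst (_≤ m) count≡ (occupied≤ occ m)))
... | suc _ = (λ ()) , suc-injective count≡

occupied≡⇒full : ∀ occ m → occupied occ m ≡ m → ∀ {s} → 1 ≤ s → s ≤ m → occ s ≢ 0
occupied≡⇒full occ zero    _      (s≤s _) ()
occupied≡⇒full occ (suc m) count≡ 1≤s s≤1+m with m≤n⇒m<n∨m≡n s≤1+m
... | inj₁ s<1+m = occupied≡⇒full occ m (proj₂ (occupied-suc≡ occ m count≡)) 1≤s (≤-pred s<1+m)
... | inj₂ refl  = proj₁ (occupied-suc≡ occ m count≡)

occupied-place-beyond : ∀ occ {j} c m → m < j → occupied (place occ j c) m ≡ occupied occ m
occupied-place-beyond occ c zero    _     = refl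
occupied-place-beyond occ c (suc m) 1+m<j =
  cong₂ _+_ (cong isOccupied (place-≢ occ (<⇒≢ 1+m<j)))
            (occupied-place-beyond occ c m (<-trans (n<1+n m) 1+m<j))

occupied-place : ∀ occ {j} c m → occ j ≡ 0 → 1 ≤ j → j ≤ m →
  occupied (place occ j (suc c)) m ≡ suc (occupied occ m)
occupied-place occ c zero    _    (s≤s _) ()
occupied-place occ c (suc m) free 1≤j j≤1+m with m≤n⇒m<n∨m≡n j≤1+m
... | inj₁ j<1+m =
  trans (cong₂ _+_ (cong isOccupied (place-≢ occ (>⇒≢ j<1+m)))
                   (occupied-place occ c m free 1≤j (≤-pred j<1+m)))
        (+-suc (isOccupied (occ (suc m))) (occupied occ m))
... | inj₂ refl =
  trans (cong₂ _+_ (cong isOccupied (place-≡ occ (suc m) (suc c)))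
                   (occupied-place-beyond occ (suc c) m (n<1+n m)))
        (cong (λ x → suc (isOccupied x + occupied occ m)) (sym free))

record IsPartialOutcome (n : ℕ) (P : ℕ → ℕ) (k : ℕ) (occ : Occ) : Set where
  field
    spot0-empty : occ 0 ≡ 0
    car≤        : ∀ s → occ s ≤ k
    injective   : ∀ {s t} → occ s ≡ occ t → occ s ≢ 0 → s ≡ t
    occupied≡   : occupied occ n ≡ k
    pref≤spot   : ∀ {s} → occ s ≢ 0 → P (occ s) ≤ s
    skipped     : ∀ {s t} → occ s ≢ 0 → P (occ s) ≤ t → t < s → occ t ≢ 0 × occ t < occ s

empty-partial : ∀ n P → IsPartialOutcome n P 0 empty
empty-partial n P = record
  { spot0-empty = refl
  ; car≤        = λ _ → z≤n
  ; injective   = λ _ nz → contradiction refl nz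
  ; occupied≡   = occupied-empty n
  ; pref≤spot   = λ nz → contradiction refl nz
  ; skipped     = λ nz → contradiction refl nz
  }

module ParkNext {n P k occ j} (I : IsPartialOutcome n P k occ)
  (j-free : occ j ≡ 0) (1≤j : 1 ≤ j) (j≤n : j ≤ n) (pref≤j : P (suc k) ≤ j)
  (passed : ∀ {t} → P (suc k) ≤ t → t < j → occ t ≢ 0) where

  open IsPartialOutcome I

  occ′ : Occ
  occ′ = place occ j (suc k)

  occ′-j : occ′ j ≡ suc k
  occ′-j = place-≡ occ j (suc k)

  occ′-off : ∀ {t} → t ≢ j → occ′ t ≡ occ t
  occ′-off = place-≢ occ

  car≤′ : ∀ s → occ′ s ≤ suc k
  car≤′ s with s ≟ j
  ... | yes refl = ≤-reflexive occ′-j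
  ... | no s≢j   = subst (_≤ suc k) (sym (occ′-off s≢j)) (m≤n⇒m≤1+n (car≤ s))

  injective′ : ∀ {s t} → occ′ s ≡ occ′ t → occ′ s ≢ 0 → s ≡ t
  injective′ {s} {t} e nz with s ≟ j | t ≟ j
  ... | yes refl | yes refl = refl
  ... | yes refl | no t≢j   =
    contradiction (trans (sym occ′-j) (trans e (occ′-off t≢j))) (>⇒≢ (s≤s (car≤ t)))
  ... | no s≢j   | yes refl =
    contradiction (trans (sym (occ′-off s≢j)) (trans e occ′-j)) (<⇒≢ (s≤s (car≤ s)))
  ... | no s≢j   | no t≢j   =
    injective (trans (sym (occ′-off s≢j)) (trans e (occ′-off t≢j)))
              (subst (_≢ 0) (occ′-off s≢j) nz)

  pref≤spot′ : ∀ {s} → occ′ s ≢ 0 → P (occ′ s) ≤ s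
  pref≤spot′ {s} nz with s ≟ j
  ... | yes refl = subst (λ c → P c ≤ s) (sym occ′-j) pref≤j
  ... | no s≢j   =
    subst (λ c → P c ≤ s) (sym (occ′-off s≢j)) (pref≤spot (subst (_≢ 0) (occ′-off s≢j) nz))

  skipped′ : ∀ {s t} → occ′ s ≢ 0 → P (occ′ s) ≤ t → t < s → occ′ t ≢ 0 × occ′ t < occ′ s
  skipped′ {s} {t} nz pref≤t t<s with s ≟ j
  ... | yes refl =
    subst (_≢ 0) (sym occ′t) (passed (subst (λ c → P c ≤ t) occ′-j pref≤t) t<s) ,
    subst₂ _<_ (sym occ′t) (sym occ′-j) (s≤s (car≤ t))
    where
    occ′t : occ′ t ≡ occ t
    occ′t = occ′-off (<⇒≢ t<s)
  ... | no s≢j   =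
    subst (_≢ 0) (sym occ′t) (proj₁ old) , subst₂ _<_ (sym occ′t) (sym occ′s) (proj₂ old)
    where
    occ′s : occ′ s ≡ occ s
    occ′s = occ′-off s≢j
    old : occ t ≢ 0 × occ t < occ s
    old = skipped (subst (_≢ 0) occ′s nz) (subst (λ c → P c ≤ t) occ′s pref≤t) t<s
    occ′t : occ′ t ≡ occ t
    occ′t = occ′-off (λ t≡j → proj₁ old (trans (cong occ t≡j) j-free))

  partial : IsPartialOutcome n P (suc k) occ′
  partial = record
    { spot0-empty = trans (occ′-off (<⇒≢ 1≤j)) spot0-empty
    ; car≤        = car≤′
    ; injective   = injective′
    ; occupied≡   = trans (occupied-place occ k n j-free 1≤j j≤n) (cong suc occupied≡)
    ; pref≤spot   = pref≤spot′
    ; skipped     = skipped′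
    }

parkFrom-partial : ∀ {n P k occ final} as → IsPartialOutcome n P k occ →
  (∀ i → entry as (suc i) ≡ P (suc k + i)) → All (λ a → 1 ≤ a × a ≤ n) as →
  parkFrom n (suc k) occ as ≡ just final → IsPartialOutcome n P (length as + k) final
parkFrom-partial [] I _ [] refl = I
parkFrom-partial {n} {P} {k} {occ} {final} (a ∷ as) I prefs ((1≤a , a≤n) ∷ in-range) parked
  with firstFree occ a (suc n ∸ a) in found
... | nothing = contradiction parked λ ()
... | just j with firstFree-sound occ a (suc n ∸ a) found
... | a≤j , j<a+[1+n∸a] , free , taken =
  subst (λ c → IsPartialOutcome n P c final) (+-suc (length as) k)
    (parkFrom-partial as (ParkNext.partial I free (≤-trans 1≤a a≤j) j≤n P[1+k]≤j passed)
                      prefs′ in-range parked)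
  where
  a≡P[1+k] : a ≡ P (suc k)
  a≡P[1+k] = trans (prefs 0) (cong (λ i → P (suc i)) (+-identityʳ k))
  P[1+k]≤j : P (suc k) ≤ j
  P[1+k]≤j = subst (_≤ j) a≡P[1+k] a≤j
  passed : ∀ {t} → P (suc k) ≤ t → t < j → occ t ≢ 0
  passed = taken ∘ subst (_≤ _) (sym a≡P[1+k])
  j≤n : j ≤ n
  j≤n = ≤-pred (subst (j <_) (m+[n∸m]≡n (m≤n⇒m≤1+n a≤n)) j<a+[1+n∸a])
  prefs′ : ∀ i → entry as (suc i) ≡ P (suc (suc k) + i)
  prefs′ i = trans (prefs (suc i)) (cong (λ i → P (suc i)) (+-suc k i))

record IsParkingOutcome (n : ℕ) (P W : ℕ → ℕ) : Set where
  field
    spot0-empty : W 0 ≡ 0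
    full        : ∀ {s} → 1 ≤ s → s ≤ n → W s ≢ 0
    injective   : ∀ {s t} → W s ≡ W t → W s ≢ 0 → s ≡ t
    pref≤spot   : ∀ {s} → W s ≢ 0 → P (W s) ≤ s
    skipped<    : ∀ {s t} → W s ≢ 0 → P (W s) ≤ t → t < s → W t < W s

partial⇒outcome : ∀ {n P occ} → IsPartialOutcome n P n occ → IsParkingOutcome n P occ
partial⇒outcome {n} {P} {occ} I = record
  { spot0-empty = spot0-empty
  ; full        = occupied≡⇒full occ n occupied≡
  ; injective   = injective
  ; pref≤spot   = pref≤spot
  ; skipped<    = λ nz pref≤t t<s → proj₂ (skipped nz pref≤t t<s)
  }
  where open IsPartialOutcome I

outcome-resp-≗ : ∀ {n P W W′} → (∀ s → W s ≡ W′ s) →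
  IsParkingOutcome n P W → IsParkingOutcome n P W′
outcome-resp-≗ {n} {P} {W} {W′} W≗W′ O = record
  { spot0-empty = trans (sym (W≗W′ 0)) spot0-empty
  ; full        = λ 1≤s s≤n → subst (_≢ 0) (W≗W′ _) (full 1≤s s≤n)
  ; injective   = λ {s} {t} e nz →
      injective (trans (W≗W′ s) (trans e (sym (W≗W′ t)))) (subst (_≢ 0) (sym (W≗W′ s)) nz)
  ; pref≤spot   = λ {s} nz →
      subst (λ c → P c ≤ s) (W≗W′ s) (pref≤spot (subst (_≢ 0) (sym (W≗W′ s)) nz))
  ; skipped<    = λ {s} {t} nz pref≤t t<s →
      subst₂ _<_ (W≗W′ t) (W≗W′ s)
        (skipped< (subst (_≢ 0) (sym (W≗W′ s)) nz)
                  (subst (λ c → P c ≤ t) (sym (W≗W′ s)) pref≤t) t<s)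
  }
  where open IsParkingOutcome O

occ≗ω : ∀ {n π occ} → park n π ≡ just occ → occ 0 ≡ 0 → ∀ s → occ s ≡ ω n π s
occ≗ω _      occ0≡0 zero = occ0≡0
occ≗ω parked _ (suc s) rewrite parked = refl

park-outcome : ∀ {n π} → IsParkingFunction n π → IsParkingOutcome n (entry π) (ω n π)
park-outcome {n} {π} (length≡n , in-range , parks) with park n π in parked | parks
... | just occ | _ =
  outcome-resp-≗ (occ≗ω parked (IsPartialOutcome.spot0-empty I)) (partial⇒outcome I)
  where
  I : IsPartialOutcome n (entry π) n occ
  I = subst (λ k → IsPartialOutcome n (entry π) k occ) (trans (+-identityʳ (length π)) length≡n)
        (parkFrom-partial π (empty-partial n (entry π)) (λ _ → refl) in-range parked)

iter-sucʳ : ∀ f m x → iter f m (f x) ≡ iter f (suc m) x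
iter-sucʳ f zero    x = refl
iter-sucʳ f (suc m) x = cong f (iter-sucʳ f m x)

module ParkingTree {n P W} (O : IsParkingOutcome n P W) (P0≡0 : P 0 ≡ 0) where

  open IsParkingOutcome O

  parentOf : ℕ → ℕ
  parentOf c = W (P c ∸ 1)

  parentSpot : ℕ → ℕ
  parentSpot s = P (W s) ∸ 1

  iter-parentOf-0 : ∀ k → iter parentOf k 0 ≡ 0
  iter-parentOf-0 zero    = refl
  iter-parentOf-0 (suc k) rewrite iter-parentOf-0 k | P0≡0 = spot0-empty

  occupied⇒1≤ : ∀ {s} → W s ≢ 0 → 1 ≤ s
  occupied⇒1≤ {zero}  nz = contradiction spot0-empty nz
  occupied⇒1≤ {suc s} _  = s≤s z≤n

  parentSpot<spot : ∀ {s} → W s ≢ 0 → parentSpot s < s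
  parentSpot<spot {zero}  nz = contradiction spot0-empty nz
  parentSpot<spot {suc s} nz = s≤s (pred-mono-≤ (pref≤spot nz))

  W∘ancestorSpot : ∀ k s → W (iter parentSpot k s) ≡ iter parentOf k (W s)
  W∘ancestorSpot zero    s = refl
  W∘ancestorSpot (suc k) s = cong parentOf (W∘ancestorSpot k s)

  ancestorSpot-left : ∀ k s → iter parentOf k (W s) ≢ 0 → k + iter parentSpot k s ≤ s
  ancestorSpot-left zero    s _  = ≤-refl
  ancestorSpot-left (suc k) s nz =
    ≤-trans (+-monoʳ-< k (parentSpot<spot (subst (_≢ 0) (sym (W∘ancestorSpot k s)) nz′)))
            (ancestorSpot-left k s nz′)
    where
    nz′ : iter parentOf k (W s) ≢ 0
    nz′ z = nz (trans (cong parentOf z) (iter-parentOf-0 1))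

  ancestor-left : ∀ {k p q} → 1 ≤ k → iter parentOf k (W q) ≢ 0 →
    W p ≡ iter parentOf k (W q) → p < q
  ancestor-left {k} {p} {q} 1≤k nz Wp≡ =
    subst (_< q) a≡p (≤-trans (+-monoˡ-≤ a 1≤k) (ancestorSpot-left k q nz))
    where
    a : ℕ
    a = iter parentSpot k q
    a≡p : a ≡ p
    a≡p = injective (trans (W∘ancestorSpot k q) (sym Wp≡))
                    (subst (_≢ 0) (sym (W∘ancestorSpot k q)) nz)

  wordRecord⇒ancestors≤ : ∀ {j} → (∀ i → 1 ≤ i → i < j → W i < W j) →
    ∀ m → iter parentOf m (W j) ≤ W j
  wordRecord⇒ancestors≤ isRecord zero = ≤-refl
  wordRecord⇒ancestors≤ {j} isRecord (suc m) with iter parentOf (suc m) (W j) ≟ 0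
  ... | yes ≡0 = subst (_≤ W j) (sym ≡0) z≤n
  ... | no  nz =
    subst (_≤ W j) (W∘ancestorSpot (suc m) j)
      (<⇒≤ (isRecord a (occupied⇒1≤ (subst (_≢ 0) (sym (W∘ancestorSpot (suc m) j)) nz))
                       (≤-trans (s≤s (m≤n+m a m)) (ancestorSpot-left (suc m) j nz))))
    where
    a : ℕ
    a = iter parentSpot (suc m) j

  ancestors≤⇒left≤ : ∀ {T} s → Acc _<_ s → s ≤ n → (∀ m → iter parentOf m (W s) ≤ T) →
    ∀ {t} → t ≤ s → W t ≤ T
  ancestors≤⇒left≤ zero _ _ _ z≤n = subst (_≤ _) (sym spot0-empty) z≤n
  ancestors≤⇒left≤ {T} s@(suc _) (acc rec) s≤n bounded {t} t≤s
    with m≤n⇒m<n∨m≡n t≤s | P (W s) ≤? t | full {s} (s≤s z≤n) s≤n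
  ... | inj₂ refl | _          | _    = bounded 0
  ... | inj₁ t<s  | yes pref≤t | Ws≢0 = ≤-trans (<⇒≤ (skipped< Ws≢0 pref≤t t<s)) (bounded 0)
  ... | inj₁ t<s  | no  pref≰t | Ws≢0 =
    ancestors≤⇒left≤ (parentSpot s) (rec up<s) (≤-trans (<⇒≤ up<s) s≤n)
      (λ m → subst (_≤ T) (sym (iter-sucʳ parentOf m (W s))) (bounded (suc m)))
      (suc[m]≤n⇒m≤pred[n] (≰⇒> pref≰t))
    where
    up<s : parentSpot s < s
    up<s = parentSpot<spot Ws≢0

  ancestors≤⇒wordRecord : ∀ {j} → j ≤ n → (∀ m → iter parentOf m (W j) ≤ W j) →
    ∀ i → 1 ≤ i → i < j → W i < W j
  ancestors≤⇒wordRecord {j} j≤n bounded i 1≤i i<j =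
    ≤∧≢⇒< (ancestors≤⇒left≤ j (<-wellFounded j) j≤n bounded (<⇒≤ i<j))
          (λ Wi≡Wj → <⇒≢ i<j (injective Wi≡Wj (full 1≤i (≤-trans (<⇒≤ i<j) j≤n))))

entry-0 : ∀ π → entry π 0 ≡ 0
entry-0 []      = refl
entry-0 (_ ∷ _) = refl

lemma3p10 : (n : ℕ) (π : List ℕ) → IsParkingFunction n π →
    ((v : ℕ) → 1 ≤ v → v ≤ n → (k : ℕ) → 1 ≤ k →
      iter (parent n π) k v ≢ 0 →
      (p q : ℕ) → 1 ≤ p → p ≤ n → 1 ≤ q → q ≤ n →
      ω n π p ≡ iter (parent n π) k v → ω n π q ≡ v → p < q)
    × ((j : ℕ) → 1 ≤ j → j ≤ n → IsWordRecordAt n π j ⇔ IsTreeRecord n π (ω n π j))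
lemma3p10 n π isPF =
  (λ { _ _ _ _ 1≤k nz _ _ _ _ _ _ Wp≡ refl → ancestor-left 1≤k nz Wp≡ }) ,
  (λ j _ j≤n → mk⇔ wordRecord⇒ancestors≤ (ancestors≤⇒wordRecord j≤n))
  where open ParkingTree (park-outcome isPF) (entry-0 π)
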